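{- Let $M\in\mathbb{R}^{n\times n}$ be invertible. Then $M$ has the strong inner product property if and only if $Y=O$ is the only matrix $Y\in\mathbb{R}^{n\times n}$ such that $YM^{ -1}$ is symmetric and $Y\circ M=O$.
   Context: All matrices are real; $\circ$ denotes the Hadamard (entrywise) product and $O$ the zero matrix. A matrix $M\in\mathbb{R}^{m\times n}$ with $m\le n$ has the strong inner product property (SIPP) if $M$ has full rank (rank $m$) and $X=O$ is the only symmetric $m\times m$ matrix $X$ satisfying $(XM)\circ M=O$. -}

module Defs where

open import Level using (Level; _⊔_) renaming (suc to lsuc)
open import Data.Nat using (ℕ; zero; suc; _≤_)
open import Data.Fin using (Fin; zero; suc)
open import Data.Product using (Σ; _×_; _,_)
open import Data.Sum using (_⊎_)
open import Relation.Nullary using (¬_)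
open import Algebra.Bundles using (CommutativeRing)

-- The real numbers, axiomatised as a (Dedekind-)complete ordered field.
-- Every such structure is (classically) isomorphic to ℝ; the theorem is
-- quantified over all of them.
record RealField (c ℓ : Level) : Set (lsuc (c ⊔ ℓ)) where
  field
    commRing : CommutativeRing c ℓ
  open CommutativeRing commRing public
  field
    _≤ᵣ_       : Carrier → Carrier → Set ℓ
    ≤-refl     : ∀ {x y} → x ≈ y → x ≤ᵣ y
    ≤-antisym  : ∀ {x y} → x ≤ᵣ y → y ≤ᵣ x → x ≈ y
    ≤-trans    : ∀ {x y z} → x ≤ᵣ y → y ≤ᵣ z → x ≤ᵣ z
    ≤-total    : ∀ x y → (x ≤ᵣ y) ⊎ (y ≤ᵣ x)
    +-mono     : ∀ {x y} z → x ≤ᵣ y → (x + z) ≤ᵣ (y + z)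
    *-nonneg   : ∀ {x y} → 0# ≤ᵣ x → 0# ≤ᵣ y → 0# ≤ᵣ (x * y)
    0≉1        : ¬ (0# ≈ 1#)
    inverse    : ∀ x → ¬ (x ≈ 0#) → Σ Carrier (λ y → (x * y) ≈ 1#)
    sup        : (P : Carrier → Set c) →
                 Σ Carrier P →
                 Σ Carrier (λ b → ∀ x → P x → x ≤ᵣ b) →
                 Σ Carrier (λ s → (∀ x → P x → x ≤ᵣ s) ×
                                  (∀ b → (∀ x → P x → x ≤ᵣ b) → s ≤ᵣ b))

module Matrices {c ℓ : Level} (R : RealField c ℓ) where
  open RealField R using (Carrier; _≈_; _+_; _*_; 0#; 1#)

  Matrix : ℕ → ℕ → Set c
  Matrix m n = Fin m → Fin n → Carrier

  ∑ : ∀ n → (Fin n → Carrier) → Carrier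
  ∑ zero    f = 0#
  ∑ (suc n) f = f zero + ∑ n (λ i → f (suc i))

  _·_ : ∀ {m k n} → Matrix m k → Matrix k n → Matrix m n
  _·_ {k = k} A B i j = ∑ k (λ l → A i l * B l j)

  _∘ₕ_ : ∀ {m n} → Matrix m n → Matrix m n → Matrix m n
  (A ∘ₕ B) i j = A i j * B i j

  O : ∀ {m n} → Matrix m n
  O i j = 0#

  I : ∀ {n} → Matrix n n
  I {suc n} zero    zero    = 1#
  I {suc n} zero    (suc j) = 0#
  I {suc n} (suc i) zero    = 0#
  I {suc n} (suc i) (suc j) = I {n} i j

  _≈ₘ_ : ∀ {m n} → Matrix m n → Matrix m n → Set ℓ
  A ≈ₘ B = ∀ i j → A i j ≈ B i j

  Symmetric : ∀ {n} → Matrix n n → Set ℓ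
  Symmetric A = ∀ i j → A i j ≈ A j i

  -- rank m for an m × n matrix (m ≤ n): rows linearly independent,
  -- i.e. the only row vector c with cᵀ M = 0 is c = 0.
  FullRank : ∀ {m n} → Matrix m n → Set (c ⊔ ℓ)
  FullRank {m} {n} M =
    (v : Fin m → Carrier) →
    (∀ j → ∑ m (λ i → v i * M i j) ≈ 0#) →
    ∀ i → v i ≈ 0#

  SIPP : ∀ {m n} → Matrix m n → Set (c ⊔ ℓ)
  SIPP {m} M = FullRank M ×
    ((X : Matrix m m) → Symmetric X → ((X · M) ∘ₕ M) ≈ₘ O → X ≈ₘ O)

  IsInverse : ∀ {n} → Matrix n n → Matrix n n → Set ℓ
  IsInverse M N = ((M · N) ≈ₘ I) × ((N · M) ≈ₘ I)

-- Since M is invertible, Y ↦ Y M⁻¹ is a bijection of n × n matrices with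
-- inverse X ↦ X M, under which Y ∘ M = O becomes (X M) ∘ M = O and "Y M⁻¹
-- symmetric" becomes "X symmetric"; so the two uniqueness conditions say the
-- same thing. Full rank is automatic: vᵀ M = 0 gives v = vᵀ M M⁻¹ = 0.
module Submission where

open import Defs
open import Level using (Level)
open import Data.Nat using (ℕ)
open import Data.Fin using (Fin)
open import Data.Product using (_×_; _,_)
import Algebra.Properties.Semiring.Sum as SemiringSum
import Relation.Binary.Reasoning.Setoid as SetoidReasoning

module MatrixProperties {c ℓ : Level} (R : RealField c ℓ) where
  open RealField R
  open Matrices R
  open SemiringSum semiring
    using (sum; sum-cong-≋; sum-replicate-zero; *-distribˡ-sum; *-distribʳ-sum)
    renaming (∑-comm to sum-comm)
  open SetoidReasoning setoid

  ∑≈sum : ∀ n (f : Fin n → Carrier) → ∑ n f ≈ sum f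
  ∑≈sum ℕ.zero    f = refl
  ∑≈sum (ℕ.suc n) f = +-congˡ (∑≈sum n (λ i → f (Fin.suc i)))

  ∑-cong : ∀ n {f g : Fin n → Carrier} → (∀ i → f i ≈ g i) → ∑ n f ≈ ∑ n g
  ∑-cong n {f} {g} f≈g = begin
    ∑ n f  ≈⟨ ∑≈sum n f ⟩
    sum f  ≈⟨ sum-cong-≋ f≈g ⟩
    sum g  ≈⟨ ∑≈sum n g ⟨
    ∑ n g  ∎

  ∑-zero : ∀ n {f : Fin n → Carrier} → (∀ i → f i ≈ 0#) → ∑ n f ≈ 0#
  ∑-zero n f≈0 = trans (∑-cong n f≈0) (trans (∑≈sum n _) (sum-replicate-zero n))

  ∑-comm : ∀ m n (f : Fin m → Fin n → Carrier) →
           ∑ m (λ i → ∑ n (f i)) ≈ ∑ n (λ j → ∑ m (λ i → f i j))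
  ∑-comm m n f = begin
    ∑ m (λ i → ∑ n (f i))                ≈⟨ trans (∑-cong m (λ i → ∑≈sum n (f i))) (∑≈sum m _) ⟩
    sum (λ i → sum (f i))                ≈⟨ sum-comm f ⟩
    sum (λ j → sum (λ i → f i j))        ≈⟨ trans (∑-cong n (λ j → ∑≈sum m _)) (∑≈sum n _) ⟨
    ∑ n (λ j → ∑ m (λ i → f i j))        ∎

  *-distribˡ-∑ : ∀ n x (f : Fin n → Carrier) → x * ∑ n f ≈ ∑ n (λ i → x * f i)
  *-distribˡ-∑ n x f = begin
    x * ∑ n f            ≈⟨ *-congˡ (∑≈sum n f) ⟩
    x * sum f            ≈⟨ *-distribˡ-sum x f ⟩
    sum (λ i → x * f i)  ≈⟨ ∑≈sum n _ ⟨
    ∑ n (λ i → x * f i)  ∎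

  *-distribʳ-∑ : ∀ n x (f : Fin n → Carrier) → ∑ n f * x ≈ ∑ n (λ i → f i * x)
  *-distribʳ-∑ n x f = begin
    ∑ n f * x            ≈⟨ *-congʳ (∑≈sum n f) ⟩
    sum f * x            ≈⟨ *-distribʳ-sum x f ⟩
    sum (λ i → f i * x)  ≈⟨ ∑≈sum n _ ⟨
    ∑ n (λ i → f i * x)  ∎

  ∑-I : ∀ k (f : Fin k → Carrier) j → ∑ k (λ l → f l * I l j) ≈ f j
  ∑-I (ℕ.suc k) f Fin.zero =
    trans (+-cong (*-identityʳ _) (∑-zero k (λ _ → zeroʳ _))) (+-identityʳ _)
  ∑-I (ℕ.suc k) f (Fin.suc j) =
    trans (+-cong (zeroʳ _) (∑-I k (λ l → f (Fin.suc l)) j)) (+-identityˡ _)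

  ·-congʳ : ∀ {a b k} {A A′ : Matrix a b} (B : Matrix b k) → A ≈ₘ A′ → (A · B) ≈ₘ (A′ · B)
  ·-congʳ {b = b} B A≈A′ i j = ∑-cong b (λ l → *-congʳ (A≈A′ i l))

  ·-congˡ : ∀ {a b k} (A : Matrix a b) {B B′ : Matrix b k} → B ≈ₘ B′ → (A · B) ≈ₘ (A · B′)
  ·-congˡ {b = b} A B≈B′ i j = ∑-cong b (λ l → *-congˡ (B≈B′ l j))

  ·-assoc : ∀ {a b k d} (A : Matrix a b) (B : Matrix b k) (C : Matrix k d) →
            ((A · B) · C) ≈ₘ (A · (B · C))
  ·-assoc {b = b} {k = k} A B C i j = begin
    ∑ k (λ l → ∑ b (λ p → A i p * B p l) * C l j)    ≈⟨ ∑-cong k (λ l → *-distribʳ-∑ b (C l j) _) ⟩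
    ∑ k (λ l → ∑ b (λ p → (A i p * B p l) * C l j))  ≈⟨ ∑-comm k b _ ⟩
    ∑ b (λ p → ∑ k (λ l → (A i p * B p l) * C l j))  ≈⟨ ∑-cong b (λ p → ∑-cong k (λ l → *-assoc _ _ _)) ⟩
    ∑ b (λ p → ∑ k (λ l → A i p * (B p l * C l j)))  ≈⟨ ∑-cong b (λ p → *-distribˡ-∑ k (A i p) _) ⟨
    ∑ b (λ p → A i p * ∑ k (λ l → B p l * C l j))    ∎

  ·-identityʳ : ∀ {a k} (A : Matrix a k) → (A · I) ≈ₘ A
  ·-identityʳ {k = k} A i j = ∑-I k (A i) j

  ·-zeroˡ : ∀ {a b k} (B : Matrix b k) → (O {a} · B) ≈ₘ O
  ·-zeroˡ {b = b} B i j = ∑-zero b (λ _ → zeroˡ _)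

  ·-cancelʳ : ∀ {a n} (A : Matrix a n) {M N : Matrix n n} → (M · N) ≈ₘ I →
              ((A · M) · N) ≈ₘ A
  ·-cancelʳ A {M} {N} M·N≈I i j = begin
    ((A · M) · N) i j  ≈⟨ ·-assoc A M N i j ⟩
    (A · (M · N)) i j  ≈⟨ ·-congˡ A M·N≈I i j ⟩
    (A · I) i j        ≈⟨ ·-identityʳ A i j ⟩
    A i j              ∎

  ·-invertible-zeroʳ : ∀ {a n} {A : Matrix a n} {M N : Matrix n n} → (M · N) ≈ₘ I →
                       (A · M) ≈ₘ O → A ≈ₘ O
  ·-invertible-zeroʳ {A = A} {M} {N} M·N≈I A·M≈O i j = begin
    A i j              ≈⟨ ·-cancelʳ A M·N≈I i j ⟨
    ((A · M) · N) i j  ≈⟨ ·-congʳ N A·M≈O i j ⟩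
    (O · N) i j        ≈⟨ ·-zeroˡ N i j ⟩
    0#                 ∎

  invertible⇒fullRank : ∀ {n} {M N : Matrix n n} → (M · N) ≈ₘ I → FullRank M
  invertible⇒fullRank M·N≈I v vᵀM≈0 =
    ·-invertible-zeroʳ {a = 1} {A = λ _ → v} M·N≈I (λ _ → vᵀM≈0) Fin.zero

  Symmetric-cong : ∀ {n} {A B : Matrix n n} → A ≈ₘ B → Symmetric A → Symmetric B
  Symmetric-cong A≈B symA i j = trans (sym (A≈B i j)) (trans (symA i j) (A≈B j i))

  ∘ₕ-congʳ : ∀ {m n} {A A′ : Matrix m n} (B : Matrix m n) → A ≈ₘ A′ → (A ∘ₕ B) ≈ₘ (A′ ∘ₕ B)
  ∘ₕ-congʳ B A≈A′ i j = *-congʳ (A≈A′ i j)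

  SIPP⇔UniqueZero : ∀ n (M N : Matrix n n) → IsInverse M N →
    (SIPP M → ((Y : Matrix n n) → Symmetric (Y · N) → (Y ∘ₕ M) ≈ₘ O → Y ≈ₘ O))
    × (((Y : Matrix n n) → Symmetric (Y · N) → (Y ∘ₕ M) ≈ₘ O → Y ≈ₘ O) → SIPP M)
  SIPP⇔UniqueZero n M N (M·N≈I , N·M≈I) = sipp⇒unique , unique⇒sipp
    where
    sipp⇒unique : SIPP M → (Y : Matrix n n) → Symmetric (Y · N) → (Y ∘ₕ M) ≈ₘ O → Y ≈ₘ O
    sipp⇒unique (_ , sipp) Y symYN Y∘M≈O = ·-invertible-zeroʳ N·M≈I YN≈O
      where
      YN≈O : (Y · N) ≈ₘ O
      YN≈O = sipp (Y · N) symYN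
        (λ i j → trans (∘ₕ-congʳ M (·-cancelʳ Y N·M≈I) i j) (Y∘M≈O i j))

    unique⇒sipp : ((Y : Matrix n n) → Symmetric (Y · N) → (Y ∘ₕ M) ≈ₘ O → Y ≈ₘ O) → SIPP M
    unique⇒sipp unique = invertible⇒fullRank M·N≈I , λ X symX XM∘M≈O →
      ·-invertible-zeroʳ M·N≈I
        (unique (X · M) (Symmetric-cong (λ i j → sym (·-cancelʳ X M·N≈I i j)) symX) XM∘M≈O)

theorem3p2 : ∀ {c ℓ} (R : RealField c ℓ) (n : ℕ)
               (M N : Matrices.Matrix R n n) →
               Matrices.IsInverse R M N →
               (Matrices.SIPP R M →
                 ((Y : Matrices.Matrix R n n) →
                   Matrices.Symmetric R (Matrices._·_ R Y N) →
                   Matrices._≈ₘ_ R (Matrices._∘ₕ_ R Y M) (Matrices.O R) →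
                   Matrices._≈ₘ_ R Y (Matrices.O R)))
               × (((Y : Matrices.Matrix R n n) →
                   Matrices.Symmetric R (Matrices._·_ R Y N) →
                   Matrices._≈ₘ_ R (Matrices._∘ₕ_ R Y M) (Matrices.O R) →
                   Matrices._≈ₘ_ R Y (Matrices.O R)) →
                 Matrices.SIPP R M)
theorem3p2 R = MatrixProperties.SIPP⇔UniqueZero R
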